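{- Let $\mathbb{F}_q$ be a finite field and let $f_1,\ldots,f_r\in\mathbb{F}_q[x_1,\ldots,x_n]$. For a subset $S\subseteq\mathbb{A}^n(\mathbb{F}_q)=\mathbb{F}_q^n$ let $\mathcal{N}(S)=\#\{\mathbf{x}\in S: f_1(\mathbf{x})=\cdots=f_r(\mathbf{x})=0\}$. Let $L_0\subseteq\mathbb{A}^n(\mathbb{F}_q)$ be an affine linear subspace. Choose an affine linear subspace $L$ of maximal dimension, $k$ say, such that $L\supseteq L_0$ and $\mathcal{N}(L)=\mathcal{N}(L_0)$. Suppose $L'\supset L$ is an affine linear subspace of dimension $k+1$ such that $\mathcal{N}(L')$ is minimal among all $(k+1)$-dimensional affine linear subspaces containing $L$. Then \[\mathcal{N}(\mathbb{A}^n(\mathbb{F}_q))\ge\mathcal{N}(L)+\frac{q^{n-k}-1}{q-1}\bigl(\mathcal{N}(L')-\mathcal{N}(L)\bigr).\]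
   Context: Affine linear subspaces are translates of vector subspaces of $\mathbb{F}_q^n$. -}

module Defs where

open import Level using (Level; _⊔_) renaming (suc to lsuc)
open import Algebra.Bundles using (CommutativeRing)
open import Data.Nat using (ℕ; zero; suc)
open import Data.Fin using (Fin)
open import Data.Fin.Properties using () renaming (_≟_ to _≟F_)
open import Data.Vec using (Vec; []; _∷_; lookup; zipWith; replicate; foldr)
open import Data.List using (List; []; _∷_; map; concatMap; allFin)
open import Data.Bool.ListAction using (any)
open import Data.Bool using (Bool; true; false; _∧_; if_then_else_)
open import Data.Product using (∃; _,_; proj₁; proj₂)
open import Function.Bundles using (Bijection)
open import Relation.Binary.Core using (Rel)
open import Relation.Binary.Definitions using (Decidable)
open import Relation.Binary.PropositionalEquality as ≡ using (_≡_)
open import Relation.Nullary using (¬_; Dec; yes; no; does)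

-- Finite fields F_q: a commutative ring (with setoid equality) that is a
-- field (0 ≠ 1, nonzero elements invertible), together with a bijection
-- Fin q ⤖ F, so that q = #F.

record FiniteField (c ℓ : Level) : Set (lsuc (c ⊔ ℓ)) where
  field
    commRing : CommutativeRing c ℓ
  open CommutativeRing commRing public
  field
    0≉1     : ¬ (0# ≈ 1#)
    inverse : ∀ x → ¬ (x ≈ 0#) → ∃ λ y → (x * y) ≈ 1#
    q       : ℕ
    enum    : Bijection (≡.setoid (Fin q)) setoid

module _ {c ℓ : Level} (𝔽 : FiniteField c ℓ) where
  open FiniteField 𝔽
  open Bijection enum using (to; injective; surjective)

  _≟_ : Decidable _≈_
  a ≟ b with surjective a | surjective b
  ... | i , hi | j , hj with i ≟F j
  ...   | yes ≡.refl = yes (trans (sym (hi ≡.refl)) (hj ≡.refl))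
  ...   | no i≢j = no (λ a≈b → i≢j (injective (trans (hi ≡.refl) (trans a≈b (sym (hj ≡.refl))))))

  elems : List Carrier
  elems = map to (allFin q)

  Point : ℕ → Set c
  Point n = Vec Carrier n

  allPoints : (m : ℕ) → List (Point m)
  allPoints zero = [] ∷ []
  allPoints (suc m) = concatMap (λ a → map (a ∷_) (allPoints m)) elems

  _≋_ : ∀ {n} → Point n → Point n → Set ℓ
  x ≋ y = ∀ i → lookup x i ≈ lookup y i

  _≋ᵇ_ : ∀ {n} → Point n → Point n → Bool
  [] ≋ᵇ [] = true
  (a ∷ x) ≋ᵇ (b ∷ y) = does (a ≟ b) ∧ (x ≋ᵇ y)

  0v : ∀ {n} → Point n
  0v = replicate _ 0#

  _+v_ : ∀ {n} → Point n → Point n → Point n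
  _+v_ = zipWith _+_

  _·v_ : ∀ {n} → Carrier → Point n → Point n
  a ·v x = Data.Vec.map (a *_) x

  lincomb : ∀ {n k} → Vec Carrier k → Vec (Point n) k → Point n
  lincomb [] [] = 0v
  lincomb (a ∷ cs) (v ∷ vs) = (a ·v v) +v lincomb cs vs

  data Poly (n : ℕ) : Set c where
    con  : Carrier → Poly n
    var  : Fin n → Poly n
    _⊕_  : Poly n → Poly n → Poly n
    _⊗_  : Poly n → Poly n → Poly n

  eval : ∀ {n} → Poly n → Point n → Carrier
  eval (con a) x = a
  eval (var i) x = lookup x i
  eval (f ⊕ g) x = eval f x + eval g x
  eval (f ⊗ g) x = eval f x * eval g x

  -- Affine linear subspaces of dimension k of A^n(F_q):
  -- translates  p + span(v_1,…,v_k)  with v_1,…,v_k linearly independent.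

  record AffSub (n k : ℕ) : Set (c ⊔ ℓ) where
    field
      base  : Point n
      dirs  : Vec (Point n) k
      indep : ∀ (cs : Vec Carrier k) → lincomb cs dirs ≋ 0v → ∀ i → lookup cs i ≈ 0#

  open AffSub public

  _∈A_ : ∀ {n k} → Point n → AffSub n k → Set (c ⊔ ℓ)
  x ∈A L = ∃ λ (cs : Vec Carrier _) → x ≋ (base L +v lincomb cs (dirs L))

  _∈Aᵇ_ : ∀ {n k} → Point n → AffSub n k → Bool
  _∈Aᵇ_ {k = k} x L = any (λ cs → x ≋ᵇ (base L +v lincomb cs (dirs L))) (allPoints k)

  _⊆A_ : ∀ {n k k'} → AffSub n k → AffSub n k' → Set (c ⊔ ℓ)
  L ⊆A M = ∀ x → x ∈A L → x ∈A M

  count : ∀ {A : Set c} → (A → Bool) → List A → ℕ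
  count P [] = 0
  count P (x ∷ xs) = if P x then suc (count P xs) else count P xs

  commonZero : ∀ {n r} → Vec (Poly n) r → Point n → Bool
  commonZero fs x = foldr _ (λ f b → does (eval f x ≟ 0#) ∧ b) true fs

  𝒩 : ∀ {n r} → Vec (Poly n) r → (Point n → Bool) → ℕ
  𝒩 {n} fs S = count (λ x → S x ∧ commonZero fs x) (allPoints n)

  𝒩A : ∀ {n r k} → Vec (Poly n) r → AffSub n k → ℕ
  𝒩A fs L = 𝒩 fs (_∈Aᵇ L)

  𝒩all : ∀ {n r} → Vec (Poly n) r → ℕ
  𝒩all fs = 𝒩 fs (λ _ → true)

module Submission where

-- Let L = p + ⟨V⟩ have dimension k and let L′ ⊇ L have dimension k + 1 and the fewest zeros
-- among such subspaces.  For every point x ∉ L the subspace M x = p + ⟨x - p, V⟩ has dimension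
-- k + 1 and contains L, so 𝒩(L′) ≤ 𝒩(M x) = 𝒩(L) + S x, where S x counts the zeros of M x
-- outside L.  Summing over the J = qⁿ - qᵏ points x ∉ L and exchanging the order of summation
-- (for x, y ∉ L one has y ∈ M x ⇔ x ∈ M y, and M y contains K = qᵏ⁺¹ - qᵏ points outside L)
-- gives  J·𝒩(L′) ≤ J·𝒩(L) + K·R  with R = 𝒩(𝔽ⁿ) - 𝒩(L); cancelling qᵏ gives the theorem.

open import Defs using (FiniteField; Poly; AffSub; base; dirs; indep; _⊆A_; 𝒩A; 𝒩all; commonZero)
import Defs as D
open import Data.Vec using (Vec)

module FiniteSums where

  open import Data.Nat using (ℕ; zero; suc; _+_; _*_; _≤_; z≤n)
  open import Data.Nat.Properties using (+-assoc; +-identityʳ; *-comm; *-zeroʳ; *-identityˡ; *-distribˡ-+; +-mono-≤; ≤-reflexive; +-commutativeSemigroup)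
  open import Algebra.Properties.CommutativeSemigroup +-commutativeSemigroup using (interchange)
  open import Data.Fin as Fin using (Fin; _≟_)
  open import Data.List using (List; []; _∷_; _++_; map; concatMap; tabulate; allFin)
  open import Data.List.Properties using (map-tabulate)
  open import Data.Bool using (Bool; true; false; _∧_; not)
  open import Data.Bool.ListAction using (any)
  open import Data.Product using (∃; _,_)
  open import Relation.Nullary using (does)
  open import Relation.Binary.PropositionalEquality using (_≡_; refl; sym; trans; cong; cong₂; module ≡-Reasoning)
  open ≡-Reasoning

  Σ : ∀ {a} {A : Set a} → List A → (A → ℕ) → ℕ
  Σ []       f = 0
  Σ (x ∷ xs) f = f x + Σ xs f

  [_] : Bool → ℕ
  [ true ]  = 1
  [ false ] = 0

  [∧]≡[]*[] : ∀ a b → [ a ∧ b ] ≡ [ a ] * [ b ]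
  [∧]≡[]*[] true  b = sym (+-identityʳ [ b ])
  [∧]≡[]*[] false b = refl

  [b]*m≤m : ∀ b m → [ b ] * m ≤ m
  [b]*m≤m true  m = ≤-reflexive (+-identityʳ m)
  [b]*m≤m false m = z≤n

  module _ {a} {A : Set a} where

    Σ-cong : ∀ (xs : List A) {f g : A → ℕ} → (∀ x → f x ≡ g x) → Σ xs f ≡ Σ xs g
    Σ-cong []       f≡g = refl
    Σ-cong (x ∷ xs) f≡g = cong₂ _+_ (f≡g x) (Σ-cong xs f≡g)

    Σ-mono : ∀ (xs : List A) {f g : A → ℕ} → (∀ x → f x ≤ g x) → Σ xs f ≤ Σ xs g
    Σ-mono []       f≤g = z≤n
    Σ-mono (x ∷ xs) f≤g = +-mono-≤ (f≤g x) (Σ-mono xs f≤g)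

    Σ-zero : ∀ (xs : List A) → Σ xs (λ _ → 0) ≡ 0
    Σ-zero []       = refl
    Σ-zero (x ∷ xs) = Σ-zero xs

    Σ-+ : ∀ (xs : List A) (f g : A → ℕ) → Σ xs (λ x → f x + g x) ≡ Σ xs f + Σ xs g
    Σ-+ []       f g = refl
    Σ-+ (x ∷ xs) f g = trans (cong ((f x + g x) +_) (Σ-+ xs f g)) (interchange (f x) (g x) (Σ xs f) (Σ xs g))

    Σ-*ˡ : ∀ (xs : List A) (m : ℕ) (f : A → ℕ) → Σ xs (λ x → m * f x) ≡ m * Σ xs f
    Σ-*ˡ []       m f = sym (*-zeroʳ m)
    Σ-*ˡ (x ∷ xs) m f = trans (cong (m * f x +_) (Σ-*ˡ xs m f)) (sym (*-distribˡ-+ m (f x) (Σ xs f)))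

    Σ-*ʳ : ∀ (xs : List A) (f : A → ℕ) (m : ℕ) → Σ xs (λ x → f x * m) ≡ Σ xs f * m
    Σ-*ʳ xs f m = trans (Σ-cong xs (λ x → *-comm (f x) m)) (trans (Σ-*ˡ xs m f) (*-comm m (Σ xs f)))

    Σ-++ : ∀ (xs ys : List A) (f : A → ℕ) → Σ (xs ++ ys) f ≡ Σ xs f + Σ ys f
    Σ-++ []       ys f = refl
    Σ-++ (x ∷ xs) ys f = trans (cong (f x +_) (Σ-++ xs ys f)) (sym (+-assoc (f x) (Σ xs f) (Σ ys f)))

  module _ {a b} {A : Set a} {B : Set b} where

    Σ-swap : ∀ (xs : List A) (ys : List B) (f : A → B → ℕ) →
             Σ xs (λ x → Σ ys (f x)) ≡ Σ ys (λ y → Σ xs (λ x → f x y))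
    Σ-swap []       ys f = sym (Σ-zero ys)
    Σ-swap (x ∷ xs) ys f = trans (cong (Σ ys (f x) +_) (Σ-swap xs ys f))
                                 (sym (Σ-+ ys (f x) (λ y → Σ xs (λ x → f x y))))

    Σ-map : ∀ (g : A → B) (xs : List A) (f : B → ℕ) → Σ (map g xs) f ≡ Σ xs (λ x → f (g x))
    Σ-map g []       f = refl
    Σ-map g (x ∷ xs) f = cong (f (g x) +_) (Σ-map g xs f)

    Σ-concatMap : ∀ (g : A → List B) (xs : List A) (f : B → ℕ) →
                  Σ (concatMap g xs) f ≡ Σ xs (λ x → Σ (g x) f)
    Σ-concatMap g []       f = refl
    Σ-concatMap g (x ∷ xs) f = trans (Σ-++ (g x) (concatMap g xs) f) (cong (Σ (g x) f +_) (Σ-concatMap g xs f))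

  module _ {a} {A : Set a} where

    Σ-select : ∀ (xs : List A) (β : A → Bool) (h : A → ℕ) (m : ℕ) → Σ xs (λ x → [ β x ]) ≡ 1 →
               (∀ x → β x ≡ true → h x ≡ m) → Σ xs (λ x → [ β x ] * h x) ≡ m
    Σ-select xs β h m once h≡m = begin
      Σ xs (λ x → [ β x ] * h x) ≡⟨ Σ-cong xs on-selected ⟩
      Σ xs (λ x → [ β x ] * m)   ≡⟨ Σ-*ʳ xs (λ x → [ β x ]) m ⟩
      Σ xs (λ x → [ β x ]) * m   ≡⟨ cong (_* m) once ⟩
      1 * m                      ≡⟨ *-identityˡ m ⟩
      m                          ∎
      where
      on-selected : ∀ x → [ β x ] * h x ≡ [ β x ] * m
      on-selected x with β x in βx
      ... | true  = cong (_+ 0) (h≡m x βx)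
      ... | false = refl

    Σ-split : ∀ (xs : List A) (B P Z : A → Bool) → (∀ x → B x ≡ true → P x ≡ true) →
              Σ xs (λ x → [ P x ∧ Z x ]) ≡ Σ xs (λ x → [ B x ∧ Z x ]) + Σ xs (λ x → [ P x ∧ (not (B x) ∧ Z x) ])
    Σ-split xs B P Z B⇒P = trans (Σ-cong xs split) (Σ-+ xs _ _)
      where
      split : ∀ x → [ P x ∧ Z x ] ≡ [ B x ∧ Z x ] + [ P x ∧ (not (B x) ∧ Z x) ]
      split x with B x in Bx
      ... | false = refl
      ... | true rewrite B⇒P x Bx = sym (+-identityʳ [ Z x ])

    any-witness : ∀ (f : A → Bool) xs → any f xs ≡ true → ∃ λ x → f x ≡ true
    any-witness f (x ∷ xs) found with f x in fx
    ... | true  = x , fx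
    ... | false = any-witness f xs found

    any-complete : ∀ (f : A → Bool) xs → 1 ≤ Σ xs (λ x → [ f x ]) → any f xs ≡ true
    any-complete f []       ()
    any-complete f (x ∷ xs) positive with f x
    ... | true  = refl
    ... | false = any-complete f xs positive

    any-false⇒Σ≡0 : ∀ (f : A → Bool) xs → any f xs ≡ false → Σ xs (λ x → [ f x ]) ≡ 0
    any-false⇒Σ≡0 f []       none = refl
    any-false⇒Σ≡0 f (x ∷ xs) none with f x
    ... | false = any-false⇒Σ≡0 f xs none

  Σ-tabulate : ∀ {a} {A : Set a} {n} (g : Fin n → A) (f : A → ℕ) → Σ (tabulate g) f ≡ Σ (allFin n) (λ i → f (g i))
  Σ-tabulate g f = trans (cong (λ xs → Σ xs f) (sym (map-tabulate (λ i → i) g))) (Σ-map g (allFin _) f)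

  Σ-allFin-const : ∀ n m → Σ (allFin n) (λ _ → m) ≡ n * m
  Σ-allFin-const zero    m = refl
  Σ-allFin-const (suc n) m = cong (m +_) (trans (Σ-tabulate (Fin.suc {n}) (λ _ → m)) (Σ-allFin-const n m))

  allFin-multiplicity : ∀ {n} (j : Fin n) → Σ (allFin n) (λ i → [ does (i ≟ j) ]) ≡ 1
  allFin-multiplicity {suc n} Fin.zero    = cong suc (trans (Σ-tabulate (Fin.suc {n}) _) (Σ-zero (allFin n)))
  allFin-multiplicity {suc n} (Fin.suc j) = trans (Σ-tabulate (Fin.suc {n}) _) (allFin-multiplicity j)

open FiniteSums

module Affine {c ℓ} (𝔽 : FiniteField c ℓ) where

  open import Level using (_⊔_)
  open import Data.Nat using (ℕ)
  open import Relation.Binary.Definitions using (Decidable)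
  open import Data.Fin using (Fin; zero; suc)
  open import Data.Vec using (Vec; []; _∷_; lookup; zipWith; map)
  open import Data.Vec.Properties using (lookup-zipWith; lookup-map; lookup-replicate)
  open import Data.Product using (∃; _,_)
  open import Data.Empty using (⊥-elim)
  open import Relation.Nullary using (¬_; yes; no)
  open import Relation.Binary.PropositionalEquality as ≡ using (_≡_)

  open FiniteField 𝔽 hiding (zero)
  open import Algebra.Properties.Ring ring using (-‿distribˡ-*; [y-z]x≈yx-zx)
  open import Algebra.Properties.AbelianGroup +-abelianGroup using (x∙y⁻¹≈ε⇒x≈y; ∙-cancelˡ; ⁻¹-∙-comm; xyx⁻¹≈y)
  open import Algebra.Properties.CommutativeSemigroup +-commutativeSemigroup using (interchange)
  open import Relation.Binary.Reasoning.Setoid setoid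

  Point : ℕ → Set c
  Point = D.Point 𝔽

  _≋_ : ∀ {n} → Point n → Point n → Set ℓ
  _≋_ = D._≋_ 𝔽

  0v : ∀ {n} → Point n
  0v = D.0v 𝔽

  _+v_ : ∀ {n} → Point n → Point n → Point n
  _+v_ = D._+v_ 𝔽

  _·v_ : ∀ {n} → Carrier → Point n → Point n
  _·v_ = D._·v_ 𝔽

  lincomb : ∀ {n k} → Vec Carrier k → Vec (Point n) k → Point n
  lincomb = D.lincomb 𝔽

  _-v_ : ∀ {n} → Point n → Point n → Point n
  _-v_ = zipWith _-_

  lookup-+v : ∀ {n} (x y : Point n) i → lookup (x +v y) i ≡ lookup x i + lookup y i
  lookup-+v x y i = lookup-zipWith _+_ i x y

  lookup--v : ∀ {n} (x y : Point n) i → lookup (x -v y) i ≡ lookup x i - lookup y i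
  lookup--v x y i = lookup-zipWith _-_ i x y

  lookup-0v : ∀ {n} (i : Fin n) → lookup (0v {n}) i ≡ 0#
  lookup-0v i = lookup-replicate i 0#

  lookup-lincomb-∷ : ∀ {n k} a (cs : Vec Carrier k) (v : Point n) D i →
                     lookup (lincomb (a ∷ cs) (v ∷ D)) i ≈ a * lookup v i + lookup (lincomb cs D) i
  lookup-lincomb-∷ a cs v D i = begin
    lookup ((a ·v v) +v lincomb cs D) i        ≡⟨ lookup-+v (a ·v v) (lincomb cs D) i ⟩
    lookup (a ·v v) i + lookup (lincomb cs D) i ≡⟨ ≡.cong (_+ _) (lookup-map i (a *_) v) ⟩
    a * lookup v i + lookup (lincomb cs D) i    ∎

  lincomb-cong : ∀ {n k} (cs ds : Vec Carrier k) (D : Vec (Point n) k) → cs ≋ ds → lincomb cs D ≋ lincomb ds D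
  lincomb-cong []       []       []      cs≋ds i = refl
  lincomb-cong (a ∷ cs) (b ∷ ds) (v ∷ D) cs≋ds i = begin
    lookup (lincomb (a ∷ cs) (v ∷ D)) i      ≈⟨ lookup-lincomb-∷ a cs v D i ⟩
    a * lookup v i + lookup (lincomb cs D) i ≈⟨ +-cong (*-congʳ (cs≋ds zero)) (lincomb-cong cs ds D (λ j → cs≋ds (suc j)) i) ⟩
    b * lookup v i + lookup (lincomb ds D) i ≈⟨ lookup-lincomb-∷ b ds v D i ⟨
    lookup (lincomb (b ∷ ds) (v ∷ D)) i      ∎

  lincomb-scale : ∀ {n k} a (cs : Vec Carrier k) (D : Vec (Point n) k) → lincomb (map (a *_) cs) D ≋ (a ·v lincomb cs D)
  lincomb-scale a []       []      i = begin
    lookup 0v i           ≡⟨ lookup-0v i ⟩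
    0#                    ≈⟨ zeroʳ a ⟨
    a * 0#                ≡⟨ ≡.cong (a *_) (lookup-0v i) ⟨
    a * lookup 0v i       ≡⟨ lookup-map i (a *_) 0v ⟨
    lookup (a ·v 0v) i    ∎
  lincomb-scale a (u ∷ cs) (v ∷ D) i = begin
    lookup (lincomb (a * u ∷ map (a *_) cs) (v ∷ D)) i       ≈⟨ lookup-lincomb-∷ (a * u) (map (a *_) cs) v D i ⟩
    (a * u) * lookup v i + lookup (lincomb (map (a *_) cs) D) i
      ≈⟨ +-cong (*-assoc a u _) (trans (lincomb-scale a cs D i) (reflexive (lookup-map i (a *_) (lincomb cs D)))) ⟩
    a * (u * lookup v i) + a * lookup (lincomb cs D) i        ≈⟨ distribˡ a _ _ ⟨
    a * (u * lookup v i + lookup (lincomb cs D) i)            ≈⟨ *-congˡ (lookup-lincomb-∷ u cs v D i) ⟨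
    a * lookup (lincomb (u ∷ cs) (v ∷ D)) i                   ≡⟨ lookup-map i (a *_) (lincomb (u ∷ cs) (v ∷ D)) ⟨
    lookup (a ·v lincomb (u ∷ cs) (v ∷ D)) i                  ∎

  lincomb-sub : ∀ {n k} (cs ds : Vec Carrier k) (D : Vec (Point n) k) → lincomb (cs -v ds) D ≋ (lincomb cs D -v lincomb ds D)
  lincomb-sub []       []       []      i = begin
    lookup 0v i                        ≡⟨ lookup-0v i ⟩
    0#                                 ≈⟨ -‿inverseʳ 0# ⟨
    0# - 0#                            ≡⟨ ≡.cong₂ _-_ (lookup-0v i) (lookup-0v i) ⟨
    lookup 0v i - lookup 0v i          ≡⟨ lookup--v 0v 0v i ⟨
    lookup (0v -v 0v) i                ∎
  lincomb-sub (u ∷ cs) (w ∷ ds) (v ∷ D) i = begin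
    lookup (lincomb (u - w ∷ (cs -v ds)) (v ∷ D)) i  ≈⟨ lookup-lincomb-∷ (u - w) (cs -v ds) v D i ⟩
    (u - w) * V + lookup (lincomb (cs -v ds) D) i    ≈⟨ +-cong ([y-z]x≈yx-zx V u w) (trans (lincomb-sub cs ds D i) (reflexive (lookup--v (lincomb cs D) (lincomb ds D) i))) ⟩
    (u * V - w * V) + (X - Y)                        ≈⟨ interchange (u * V) (- (w * V)) X (- Y) ⟩
    (u * V + X) + (- (w * V) + - Y)                  ≈⟨ +-congˡ (⁻¹-∙-comm (w * V) Y) ⟩
    (u * V + X) - (w * V + Y)                        ≈⟨ +-cong (lookup-lincomb-∷ u cs v D i) (-‿cong (lookup-lincomb-∷ w ds v D i)) ⟨
    lookup (lincomb (u ∷ cs) (v ∷ D)) i - lookup (lincomb (w ∷ ds) (v ∷ D)) i ≡⟨ lookup--v (lincomb (u ∷ cs) (v ∷ D)) (lincomb (w ∷ ds) (v ∷ D)) i ⟨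
    lookup (lincomb (u ∷ cs) (v ∷ D) -v lincomb (w ∷ ds) (v ∷ D)) i ∎
    where
    V X Y : Carrier
    V = lookup v i
    X = lookup (lincomb cs D) i
    Y = lookup (lincomb ds D) i

  affPoint : ∀ {n m} → Point n → Vec (Point n) m → Vec Carrier m → Point n
  affPoint b D cs = b +v lincomb cs D

  InSpan : ∀ {n m} → Point n → Vec (Point n) m → Point n → Set (c ⊔ ℓ)
  InSpan b D x = ∃ λ cs → x ≋ affPoint b D cs

  Independent : ∀ {n m} → Vec (Point n) m → Set (c ⊔ ℓ)
  Independent {m = m} D = ∀ (cs : Vec Carrier m) → lincomb cs D ≋ 0v → ∀ i → lookup cs i ≈ 0#

  affPoint-cong : ∀ {n m} (b : Point n) (D : Vec (Point n) m) cs ds → cs ≋ ds → affPoint b D cs ≋ affPoint b D ds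
  affPoint-cong b D cs ds cs≋ds i = begin
    lookup (affPoint b D cs) i               ≡⟨ lookup-+v b (lincomb cs D) i ⟩
    lookup b i + lookup (lincomb cs D) i     ≈⟨ +-congˡ (lincomb-cong cs ds D cs≋ds i) ⟩
    lookup b i + lookup (lincomb ds D) i     ≡⟨ lookup-+v b (lincomb ds D) i ⟨
    lookup (affPoint b D ds) i               ∎

  affPoint-injective : ∀ {n m} (b : Point n) (D : Vec (Point n) m) → Independent D →
                       ∀ cs ds → affPoint b D cs ≋ affPoint b D ds → cs ≋ ds
  affPoint-injective b D indep cs ds same i =
    x∙y⁻¹≈ε⇒x≈y _ _ (trans (reflexive (≡.sym (lookup--v cs ds i))) (indep (cs -v ds) difference-vanishes i))
    where
    same-lincomb : lincomb cs D ≋ lincomb ds D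
    same-lincomb j = ∙-cancelˡ (lookup b j) _ _ (begin
      lookup b j + lookup (lincomb cs D) j ≡⟨ lookup-+v b (lincomb cs D) j ⟨
      lookup (affPoint b D cs) j           ≈⟨ same j ⟩
      lookup (affPoint b D ds) j           ≡⟨ lookup-+v b (lincomb ds D) j ⟩
      lookup b j + lookup (lincomb ds D) j ∎)
    difference-vanishes : lincomb (cs -v ds) D ≋ 0v
    difference-vanishes j = begin
      lookup (lincomb (cs -v ds) D) j                      ≈⟨ lincomb-sub cs ds D j ⟩
      lookup (lincomb cs D -v lincomb ds D) j              ≡⟨ lookup--v (lincomb cs D) (lincomb ds D) j ⟩
      lookup (lincomb cs D) j - lookup (lincomb ds D) j    ≈⟨ +-congˡ (-‿cong (same-lincomb j)) ⟨
      lookup (lincomb cs D) j - lookup (lincomb cs D) j    ≈⟨ -‿inverseʳ _ ⟩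
      0#                                                   ≡⟨ lookup-0v j ⟨
      lookup 0v j                                          ∎

  lincomb-drop : ∀ {n m} a (d : Point n) cs (D : Vec (Point n) m) → (∀ i → a * lookup d i ≈ 0#) →
                 lincomb (a ∷ cs) (d ∷ D) ≋ lincomb cs D
  lincomb-drop a d cs D ad≈0 i = trans (lookup-lincomb-∷ a cs d D i) (trans (+-congʳ (ad≈0 i)) (+-identityˡ _))

  affPoint-drop : ∀ {n m} (b : Point n) a (d : Point n) cs (D : Vec (Point n) m) → (∀ i → a * lookup d i ≈ 0#) →
                  affPoint b (d ∷ D) (a ∷ cs) ≋ affPoint b D cs
  affPoint-drop b a d cs D ad≈0 i = begin
    lookup (affPoint b (d ∷ D) (a ∷ cs)) i             ≡⟨ lookup-+v b (lincomb (a ∷ cs) (d ∷ D)) i ⟩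
    lookup b i + lookup (lincomb (a ∷ cs) (d ∷ D)) i   ≈⟨ +-congˡ (lincomb-drop a d cs D ad≈0 i) ⟩
    lookup b i + lookup (lincomb cs D) i               ≡⟨ lookup-+v b (lincomb cs D) i ⟨
    lookup (affPoint b D cs) i                         ∎

  InSpan-extend : ∀ {n m} (b d : Point n) (D : Vec (Point n) m) y → InSpan b D y → InSpan b (d ∷ D) y
  InSpan-extend b d D y (cs , y≋) =
    (0# ∷ cs) , λ i → trans (y≋ i) (sym (affPoint-drop b 0# d cs D (λ _ → zeroˡ _) i))

  exchange-scalar : ∀ {c e x p z W} → c * e ≈ 1# → z ≈ p + (c * (x - p) + W) →
                    x ≈ p + (e * (z - p) + (- e) * W)
  exchange-scalar {c} {e} {x} {p} {z} {W} ce≈1 z≈ = sym (begin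
    p + (e * (z - p) + (- e) * W)                        ≈⟨ +-congˡ (+-congʳ (*-congˡ z-p≈)) ⟩
    p + (e * (c * (x - p) + W) + (- e) * W)              ≈⟨ +-congˡ (+-congʳ (distribˡ e _ W)) ⟩
    p + ((e * (c * (x - p)) + e * W) + (- e) * W)        ≈⟨ +-congˡ (+-assoc _ (e * W) _) ⟩
    p + (e * (c * (x - p)) + (e * W + (- e) * W))        ≈⟨ +-congˡ (+-cong ec[x-p]≈x-p eW-eW≈0) ⟩
    p + ((x - p) + 0#)                                   ≈⟨ +-congˡ (+-identityʳ _) ⟩
    p + (x - p)                                          ≈⟨ +-assoc p x (- p) ⟨
    (p + x) - p                                          ≈⟨ xyx⁻¹≈y p x ⟩
    x                                                    ∎)
    where
    z-p≈ : z - p ≈ c * (x - p) + W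
    z-p≈ = trans (+-congʳ z≈) (xyx⁻¹≈y p _)
    ec[x-p]≈x-p : e * (c * (x - p)) ≈ x - p
    ec[x-p]≈x-p = trans (sym (*-assoc e c _)) (trans (*-congʳ (trans (*-comm e c) ce≈1)) (*-identityˡ _))
    eW-eW≈0 : e * W + (- e) * W ≈ 0#
    eW-eW≈0 = trans (+-congˡ (sym (-‿distribˡ-* e W))) (-‿inverseʳ _)

  exchange : ∀ {n m} {c e} (b x z : Point n) cs (D : Vec (Point n) m) → c * e ≈ 1# →
             z ≋ affPoint b ((x -v b) ∷ D) (c ∷ cs) → x ≋ affPoint b ((z -v b) ∷ D) (e ∷ map ((- e) *_) cs)
  exchange {c = c} {e} b x z cs D ce≈1 z≋ i = begin
    lookup x i                                                  ≈⟨ exchange-scalar ce≈1 z≈ ⟩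
    lookup b i + (e * (lookup z i - lookup b i) + (- e) * W)    ≈⟨ +-congˡ (sym expand) ⟩
    lookup b i + lookup (lincomb (e ∷ map ((- e) *_) cs) ((z -v b) ∷ D)) i
      ≡⟨ lookup-+v b (lincomb (e ∷ map ((- e) *_) cs) ((z -v b) ∷ D)) i ⟨
    lookup (affPoint b ((z -v b) ∷ D) (e ∷ map ((- e) *_) cs)) i ∎
    where
    W : Carrier
    W = lookup (lincomb cs D) i
    z≈ : lookup z i ≈ lookup b i + (c * (lookup x i - lookup b i) + W)
    z≈ = begin
      lookup z i                                                ≈⟨ z≋ i ⟩
      lookup (affPoint b ((x -v b) ∷ D) (c ∷ cs)) i             ≡⟨ lookup-+v b (lincomb (c ∷ cs) ((x -v b) ∷ D)) i ⟩
      lookup b i + lookup (lincomb (c ∷ cs) ((x -v b) ∷ D)) i   ≈⟨ +-congˡ (lookup-lincomb-∷ c cs (x -v b) D i) ⟩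
      lookup b i + (c * lookup (x -v b) i + W)                  ≡⟨ ≡.cong (λ t → lookup b i + (c * t + W)) (lookup--v x b i) ⟩
      lookup b i + (c * (lookup x i - lookup b i) + W)          ∎
    expand : lookup (lincomb (e ∷ map ((- e) *_) cs) ((z -v b) ∷ D)) i ≈ e * (lookup z i - lookup b i) + (- e) * W
    expand = begin
      lookup (lincomb (e ∷ map ((- e) *_) cs) ((z -v b) ∷ D)) i               ≈⟨ lookup-lincomb-∷ e (map ((- e) *_) cs) (z -v b) D i ⟩
      e * lookup (z -v b) i + lookup (lincomb (map ((- e) *_) cs) D) i        ≈⟨ +-congˡ (lincomb-scale (- e) cs D i) ⟩
      e * lookup (z -v b) i + lookup ((- e) ·v lincomb cs D) i                ≡⟨ ≡.cong₂ (λ s t → e * s + t) (lookup--v z b i) (lookup-map i ((- e) *_) (lincomb cs D)) ⟩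
      e * (lookup z i - lookup b i) + (- e) * W                               ∎

  _≟_ : Decidable _≈_
  _≟_ = D._≟_ 𝔽

  InSpan-first-zero : ∀ {n m} (b d y : Point n) (D : Vec (Point n) m) a cs → a ≈ 0# →
                      y ≋ affPoint b (d ∷ D) (a ∷ cs) → InSpan b D y
  InSpan-first-zero b d y D a cs a≈0 y≋ =
    cs , λ i → trans (y≋ i) (affPoint-drop b a d cs D (λ _ → trans (*-congʳ a≈0) (zeroˡ _)) i)

  extend-independent : ∀ {n m} (b x : Point n) (D : Vec (Point n) m) → Independent D → ¬ InSpan b D x →
                       Independent ((x -v b) ∷ D)
  extend-independent b x D indep x∉ (c ∷ cs) vanishes with c ≟ 0#
  ... | yes c≈0 = λ { zero → c≈0 ; (suc i) → indep cs (λ j → trans (sym (lincomb-drop c (x -v b) cs D c*≈0 j)) (vanishes j)) i }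
    where
    c*≈0 : ∀ j → c * lookup (x -v b) j ≈ 0#
    c*≈0 j = trans (*-congʳ c≈0) (zeroˡ _)
  ... | no c≉0 with inverse c c≉0
  ...   | e , ce≈1 = ⊥-elim (x∉ (map ((- e) *_) cs , λ j → trans (x≋ j) (affPoint-drop b e (b -v b) (map ((- e) *_) cs) D e[b-b]≈0 j)))
    where
    b≋ : b ≋ affPoint b ((x -v b) ∷ D) (c ∷ cs)
    b≋ j = sym (begin
      lookup (affPoint b ((x -v b) ∷ D) (c ∷ cs)) j             ≡⟨ lookup-+v b (lincomb (c ∷ cs) ((x -v b) ∷ D)) j ⟩
      lookup b j + lookup (lincomb (c ∷ cs) ((x -v b) ∷ D)) j   ≈⟨ +-congˡ (vanishes j) ⟩
      lookup b j + lookup 0v j                                  ≡⟨ ≡.cong (lookup b j +_) (lookup-0v j) ⟩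
      lookup b j + 0#                                           ≈⟨ +-identityʳ _ ⟩
      lookup b j                                                ∎)
    x≋ : x ≋ affPoint b ((b -v b) ∷ D) (e ∷ map ((- e) *_) cs)
    x≋ = exchange b x b cs D ce≈1 b≋
    e[b-b]≈0 : ∀ j → e * lookup (b -v b) j ≈ 0#
    e[b-b]≈0 j = trans (*-congˡ (trans (reflexive (lookup--v b b j)) (-‿inverseʳ _))) (zeroʳ e)

  extend-swap : ∀ {n m} (b x y : Point n) (D : Vec (Point n) m) → ¬ InSpan b D y →
                InSpan b ((x -v b) ∷ D) y → InSpan b ((y -v b) ∷ D) x
  extend-swap b x y D y∉ ((c ∷ cs) , y≋) with c ≟ 0#
  ... | yes c≈0 = ⊥-elim (y∉ (InSpan-first-zero b (x -v b) y D c cs c≈0 y≋))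
  ... | no c≉0 with inverse c c≉0
  ...   | e , ce≈1 = (e ∷ map ((- e) *_) cs) , exchange b x y cs D ce≈1 y≋

module Enumeration {c ℓ} (𝔽 : FiniteField c ℓ) where

  open import Data.Nat using (ℕ; zero; suc; _*_; _^_; _≤_; NonZero)
  open import Data.Fin using (Fin; zero; suc)
  open import Data.Vec using (Vec; []; _∷_)
  open import Data.Product using (_,_; proj₁; proj₂)
  open import Data.Empty using (⊥-elim)
  open import Data.Bool using (Bool; true; false; _∧_)
  open import Data.Bool.ListAction using (any)
  open import Data.Bool.Properties using (⇔→≡)
  open import Function.Bundles using (mk⇔)
  open import Data.List as List using (List; []; _∷_; allFin; concatMap)
  open import Data.Nat.Properties using (*-identityʳ; module ≤-Reasoning)
  open import Data.Fin.Properties using (nonZeroIndex) renaming (_≟_ to _≟F_)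
  open import Relation.Nullary using (does; yes; no)
  open import Relation.Nullary.Decidable using (dec-true; dec-false)
  open import Function.Bundles using (Bijection)
  open import Relation.Binary.PropositionalEquality using (_≡_; refl; sym; trans; cong; module ≡-Reasoning)

  open FiniteField 𝔽 using (Carrier; _≈_; 0#; q; enum) renaming (sym to ≈-sym; trans to ≈-trans)
  open Affine 𝔽

  _≋ᵇ_ : ∀ {n} → Point n → Point n → Bool
  _≋ᵇ_ = D._≋ᵇ_ 𝔽

  elems : List Carrier
  elems = D.elems 𝔽

  allPoints : (m : ℕ) → List (Point m)
  allPoints = D.allPoints 𝔽

  open Bijection enum using (to; injective; surjective)

  ≋ᵇ-sound : ∀ {n} (x y : Point n) → x ≋ᵇ y ≡ true → x ≋ y
  ≋ᵇ-sound []      []      _    ()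
  ≋ᵇ-sound (a ∷ x) (b ∷ y) x≋ᵇy with a ≟ b
  ... | yes a≈b = λ { zero → a≈b ; (suc i) → ≋ᵇ-sound x y x≋ᵇy i }

  ≋ᵇ-complete : ∀ {n} (x y : Point n) → x ≋ y → x ≋ᵇ y ≡ true
  ≋ᵇ-complete []      []      x≋y = refl
  ≋ᵇ-complete (a ∷ x) (b ∷ y) x≋y with a ≟ b
  ... | yes _   = ≋ᵇ-complete x y (λ i → x≋y (suc i))
  ... | no  a≉b = ⊥-elim (a≉b (x≋y zero))

  elems-multiplicity : ∀ b → Σ elems (λ a → [ does (a ≟ b) ]) ≡ 1
  elems-multiplicity b = trans (Σ-map to (allFin q) _)
    (trans (Σ-cong (allFin q) (λ i → cong [_] (same-test i))) (allFin-multiplicity j))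
    where
    j : Fin q
    j = proj₁ (surjective b)
    to-j≈b : to j ≈ b
    to-j≈b = proj₂ (surjective b) refl
    same-test : ∀ i → does (to i ≟ b) ≡ does (i ≟F j)
    same-test i with i ≟F j
    ... | yes refl = dec-true (to j ≟ b) to-j≈b
    ... | no  i≢j    = dec-false (to i ≟ b) (λ to-i≈b → i≢j (injective (≈-trans to-i≈b (≈-sym to-j≈b))))

  allPoints-multiplicity : ∀ m (y : Point m) → Σ (allPoints m) (λ x → [ x ≋ᵇ y ]) ≡ 1
  allPoints-multiplicity zero    []      = refl
  allPoints-multiplicity (suc m) (b ∷ y) = begin
    Σ (concatMap (λ a → List.map (a ∷_) (allPoints m)) elems) (λ x → [ x ≋ᵇ (b ∷ y) ])
      ≡⟨ Σ-concatMap (λ a → List.map (a ∷_) (allPoints m)) elems _ ⟩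
    Σ elems (λ a → Σ (List.map (a ∷_) (allPoints m)) (λ x → [ x ≋ᵇ (b ∷ y) ]))
      ≡⟨ Σ-cong elems (λ a → Σ-map (a ∷_) (allPoints m) _) ⟩
    Σ elems (λ a → Σ (allPoints m) (λ x → [ does (a ≟ b) ∧ (x ≋ᵇ y) ]))
      ≡⟨ Σ-cong elems (λ a → trans (Σ-cong (allPoints m) (λ x → [∧]≡[]*[] (does (a ≟ b)) (x ≋ᵇ y)))
                                      (Σ-*ˡ (allPoints m) [ does (a ≟ b) ] (λ x → [ x ≋ᵇ y ]))) ⟩
    Σ elems (λ a → [ does (a ≟ b) ] * Σ (allPoints m) (λ x → [ x ≋ᵇ y ]))
      ≡⟨ Σ-cong elems (λ a → trans (cong ([ does (a ≟ b) ] *_) (allPoints-multiplicity m y)) (*-identityʳ _)) ⟩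
    Σ elems (λ a → [ does (a ≟ b) ])
      ≡⟨ elems-multiplicity b ⟩
    1 ∎
    where open ≡-Reasoning

  #allPoints : ∀ m → Σ (allPoints m) (λ _ → 1) ≡ q ^ m
  #allPoints zero    = refl
  #allPoints (suc m) = begin
    Σ (concatMap (λ a → List.map (a ∷_) (allPoints m)) elems) (λ _ → 1)
      ≡⟨ Σ-concatMap (λ a → List.map (a ∷_) (allPoints m)) elems _ ⟩
    Σ elems (λ a → Σ (List.map (a ∷_) (allPoints m)) (λ _ → 1))
      ≡⟨ Σ-cong elems (λ a → trans (Σ-map (a ∷_) (allPoints m) _) (#allPoints m)) ⟩
    Σ elems (λ _ → q ^ m)
      ≡⟨ trans (Σ-map to (allFin q) _) (Σ-allFin-const q (q ^ m)) ⟩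
    q * q ^ m ∎
    where open ≡-Reasoning

  inSpanᵇ : ∀ {n m} → Point n → Vec (Point n) m → Point n → Bool
  inSpanᵇ {m = m} b D x = any (λ cs → x ≋ᵇ affPoint b D cs) (allPoints m)

  inSpanᵇ-sound : ∀ {n m} (b : Point n) (D : Vec (Point n) m) x → inSpanᵇ b D x ≡ true → InSpan b D x
  inSpanᵇ-sound {m = m} b D x found with any-witness (λ cs → x ≋ᵇ affPoint b D cs) (allPoints m) found
  ... | cs , x≋ᵇ = cs , ≋ᵇ-sound x (affPoint b D cs) x≋ᵇ

  coordinates-exist : ∀ {n m} (b : Point n) (D : Vec (Point n) m) x → InSpan b D x →
                      1 ≤ Σ (allPoints m) (λ u → [ x ≋ᵇ affPoint b D u ])
  coordinates-exist {m = m} b D x (cs , x≋) = begin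
    1                                                                ≡⟨ Σ-select (allPoints m) (_≋ᵇ cs) isCoordinate 1 (allPoints-multiplicity m cs) coordinate-of-x ⟨
    Σ (allPoints m) (λ u → [ u ≋ᵇ cs ] * isCoordinate u)             ≤⟨ Σ-mono (allPoints m) (λ u → [b]*m≤m (u ≋ᵇ cs) (isCoordinate u)) ⟩
    Σ (allPoints m) isCoordinate                                     ∎
    where
    open ≤-Reasoning
    isCoordinate : Vec Carrier m → ℕ
    isCoordinate u = [ x ≋ᵇ affPoint b D u ]
    coordinate-of-x : ∀ u → u ≋ᵇ cs ≡ true → isCoordinate u ≡ 1
    coordinate-of-x u u≋ᵇcs = cong [_] (≋ᵇ-complete x (affPoint b D u)
      (λ i → ≈-trans (x≋ i) (affPoint-cong b D cs u (λ j → ≈-sym (≋ᵇ-sound u cs u≋ᵇcs j)) i)))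

  inSpanᵇ-complete : ∀ {n m} (b : Point n) (D : Vec (Point n) m) x → InSpan b D x → inSpanᵇ b D x ≡ true
  inSpanᵇ-complete {m = m} b D x x∈ = any-complete (λ u → x ≋ᵇ affPoint b D u) (allPoints m) (coordinates-exist b D x x∈)

  inSpanᵇ-counts-coordinates : ∀ {n m} (b : Point n) (D : Vec (Point n) m) → Independent D → ∀ x →
                               [ inSpanᵇ b D x ] ≡ Σ (allPoints m) (λ u → [ x ≋ᵇ affPoint b D u ])
  inSpanᵇ-counts-coordinates {m = m} b D indep x with inSpanᵇ b D x in found
  ... | false = sym (any-false⇒Σ≡0 (λ u → x ≋ᵇ affPoint b D u) (allPoints m) found)
  ... | true with inSpanᵇ-sound b D x found
  ...   | cs , x≋ = sym (trans (Σ-cong (allPoints m) (λ u → cong [_] (same-test u))) (allPoints-multiplicity m cs))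
    where
    same-test : ∀ u → x ≋ᵇ affPoint b D u ≡ u ≋ᵇ cs
    same-test u = ⇔→≡ (mk⇔
      (λ x≋ᵇ → ≋ᵇ-complete u cs (affPoint-injective b D indep u cs
                 (λ i → ≈-trans (≈-sym (≋ᵇ-sound x (affPoint b D u) x≋ᵇ i)) (x≋ i))))
      (λ u≋ᵇcs → ≋ᵇ-complete x (affPoint b D u)
                 (λ i → ≈-trans (x≋ i) (affPoint-cong b D cs u (λ j → ≈-sym (≋ᵇ-sound u cs u≋ᵇcs j)) i))))

  #InSpan : ∀ {n m} (b : Point n) (D : Vec (Point n) m) → Independent D →
            Σ (allPoints n) (λ x → [ inSpanᵇ b D x ]) ≡ q ^ m
  #InSpan {n} {m} b D indep = begin
    Σ (allPoints n) (λ x → [ inSpanᵇ b D x ])                                 ≡⟨ Σ-cong (allPoints n) (inSpanᵇ-counts-coordinates b D indep) ⟩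
    Σ (allPoints n) (λ x → Σ (allPoints m) (λ u → [ x ≋ᵇ affPoint b D u ]))  ≡⟨ Σ-swap (allPoints n) (allPoints m) _ ⟩
    Σ (allPoints m) (λ u → Σ (allPoints n) (λ x → [ x ≋ᵇ affPoint b D u ]))  ≡⟨ Σ-cong (allPoints m) (λ u → allPoints-multiplicity n (affPoint b D u)) ⟩
    Σ (allPoints m) (λ _ → 1)                                                 ≡⟨ #allPoints m ⟩
    q ^ m                                                                     ∎
    where open ≡-Reasoning

  count-Σ : ∀ {A : Set c} (P : A → Bool) (xs : List A) → D.count 𝔽 P xs ≡ Σ xs (λ x → [ P x ])
  count-Σ P []       = refl
  count-Σ P (x ∷ xs) with P x
  ... | true  = cong suc (count-Σ P xs)
  ... | false = count-Σ P xs

  -- 𝔽 is inhabited, so q ≠ 0.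
  q≢0 : NonZero q
  q≢0 = nonZeroIndex (proj₁ (surjective 0#))

module Arithmetic where

  open import Data.Nat as ℕ using (ℕ; zero; suc; _∸_; _^_; z≤n)
  import Data.Nat.Properties as ℕ
  open import Data.Integer using (ℤ; +_; _*_; _-_; _≤_; _≥_; 0ℤ) renaming (_+_ to _+ℤ_)
  open import Data.Integer.Properties using (i≤j⇒0≤j-i; 0≤i-j⇒j≤i; pos-*; pos-+)
  open import Data.Integer.Tactic.RingSolver using (solve-∀)
  open import Relation.Binary.PropositionalEquality using (_≡_; refl; sym; trans; cong; cong₂; subst; subst₂; module ≡-Reasoning)
  open import Relation.Nullary using (yes; no; contradiction)
  import Data.Integer

  -- In any ordered ring: v·N' ≤ v·N + u·R  ⇒  u·N + v·(N' - N) ≤ u·(N + R),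
  -- because both sides differ by the same amount.
  rearrange : ∀ (u v N N' R : ℤ) → v * N' ≤ v * N +ℤ u * R → u * N +ℤ v * (N' - N) ≤ u * (N +ℤ R)
  rearrange u v N N' R h = 0≤i-j⇒j≤i (subst (0ℤ ≤_) (same-gap u v N N' R) (i≤j⇒0≤j-i h))
    where
    same-gap : ∀ u v N N' R → (v * N +ℤ u * R) - v * N' ≡ u * (N +ℤ R) - (u * N +ℤ v * (N' - N))
    same-gap = solve-∀

  rearrange-ℕ : ∀ u v N N' R → v ℕ.* N' ℕ.≤ v ℕ.* N ℕ.+ u ℕ.* R →
                (+ u) * (+ N) +ℤ (+ v) * ((+ N') - (+ N)) ≤ (+ u) * (+ (N ℕ.+ R))
  rearrange-ℕ u v N N' R h = rearrange (+ u) (+ v) (+ N) (+ N') (+ R) (subst₂ _≤_ (pos-* v N') rhs (Data.Integer.+≤+ h))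
    where
    rhs : + (v ℕ.* N ℕ.+ u ℕ.* R) ≡ (+ v) * (+ N) +ℤ (+ u) * (+ R)
    rhs = trans (pos-+ (v ℕ.* N) (u ℕ.* R)) (cong₂ _+ℤ_ (pos-* v N) (pos-* u R))

  cancel-factor : ∀ Q u v N N' R → .{{ℕ.NonZero Q}} →
                  (Q ℕ.* v) ℕ.* N' ℕ.≤ (Q ℕ.* v) ℕ.* N ℕ.+ (Q ℕ.* u) ℕ.* R → v ℕ.* N' ℕ.≤ v ℕ.* N ℕ.+ u ℕ.* R
  cancel-factor Q u v N N' R h = ℕ.*-cancelˡ-≤ Q (subst₂ ℕ._≤_ (ℕ.*-assoc Q v N') factor-out h)
    where
    factor-out : (Q ℕ.* v) ℕ.* N ℕ.+ (Q ℕ.* u) ℕ.* R ≡ Q ℕ.* (v ℕ.* N ℕ.+ u ℕ.* R)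
    factor-out = trans (cong₂ ℕ._+_ (ℕ.*-assoc Q v N) (ℕ.*-assoc Q u R)) (sym (ℕ.*-distribˡ-+ Q (v ℕ.* N) (u ℕ.* R)))

  excess-factor : ∀ Q J v → J ℕ.+ Q ≡ Q ℕ.* suc v → J ≡ Q ℕ.* v
  excess-factor Q J v h = ℕ.+-cancelʳ-≡ Q J (Q ℕ.* v) (trans h (trans (ℕ.*-suc Q v) (ℕ.+-comm Q (Q ℕ.* v))))

  final-inequality : ∀ q k n Nall N R N' J K → Nall ≡ N ℕ.+ R → 1 ℕ.≤ q → J ℕ.+ q ^ k ≡ q ^ n → K ℕ.+ q ^ k ≡ q ^ suc k →
                     J ℕ.* N' ℕ.≤ J ℕ.* N ℕ.+ K ℕ.* R →
                     (+ (q ∸ 1)) * (+ Nall) ≥ (+ (q ∸ 1)) * (+ N) +ℤ ((+ (q ^ (n ∸ k))) - (+ 1)) * ((+ N') - (+ N))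
  final-inequality (suc u) k n _ N R N' J K refl _ #J #K counted with k ℕ.≤? n
  ... | no k≰n rewrite ℕ.m≤n⇒m∸n≡0 (ℕ.≰⇒≥ k≰n) = rearrange-ℕ u 0 N N' R z≤n
  ... | yes k≤n with suc u ^ (n ∸ k) in qⁿ⁻ᵏ
  ...   | zero  = contradiction qⁿ⁻ᵏ (ℕ.≢-nonZero⁻¹ _ {{ℕ.m^n≢0 (suc u) (n ∸ k)}})
  ...   | suc v = rearrange-ℕ u v N N' R (cancel-factor Q u v N N' R (subst₂ (λ J K → J ℕ.* N' ℕ.≤ J ℕ.* N ℕ.+ K ℕ.* R) J≡Qv K≡Qu counted))
    where
    Q : ℕ
    Q = suc u ^ k
    instance
      Q≢0 : ℕ.NonZero Q
      Q≢0 = ℕ.m^n≢0 (suc u) k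
    K≡Qu : K ≡ Q ℕ.* u
    K≡Qu = excess-factor Q K u (trans #K (ℕ.*-comm (suc u) Q))
    J≡Qv : J ≡ Q ℕ.* v
    J≡Qv = excess-factor Q J v (begin
      J ℕ.+ Q                 ≡⟨ #J ⟩
      suc u ^ n               ≡⟨ cong (suc u ^_) (ℕ.m+[n∸m]≡n k≤n) ⟨
      suc u ^ (k ℕ.+ (n ∸ k)) ≡⟨ ℕ.^-distribˡ-+-* (suc u) k (n ∸ k) ⟩
      Q ℕ.* suc u ^ (n ∸ k)   ≡⟨ cong (Q ℕ.*_) qⁿ⁻ᵏ ⟩
      Q ℕ.* suc v             ∎)
      where open ≡-Reasoning

open Arithmetic

module DoubleCounting {c ℓ} (𝔽 : FiniteField c ℓ) {n r} (fs : Vec (Poly 𝔽 n) r) {k} (L : AffSub 𝔽 n k) where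

  open import Data.Nat using (ℕ; suc; _+_; _*_; _^_; _≤_; _∸_; z≤n)
  open import Data.Nat.Properties using (+-comm; ≤-trans; m+n∸n≡m; *-monoʳ-≤; *-distribˡ-+; *-comm; m∸n+n≡m; ^-monoʳ-≤; n≤1+n; ≤-reflexive; module ≤-Reasoning)
  open import Data.Bool using (Bool; true; false; _∧_; not)
  open import Data.Bool.Properties using (∧-zeroʳ; ∧-identityʳ; ∧-comm; ⇔→≡)
  open import Data.Vec using (Vec; _∷_)
  open import Data.List using (List)
  open import Function.Bundles using (mk⇔)
  open import Relation.Nullary using (¬_)
  open import Relation.Binary.PropositionalEquality using (_≡_; refl; sym; trans; cong; cong₂; module ≡-Reasoning)

  open Affine 𝔽 using (Point; _-v_; InSpan; InSpan-extend; extend-independent; extend-swap)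
  open Enumeration 𝔽
  open FiniteField 𝔽 using (q)

  p : Point n
  p = base L

  V : Vec (Point n) k
  V = dirs L

  𝔸 : List (Point n)
  𝔸 = allPoints n

  inL : Point n → Bool
  inL = inSpanᵇ p V

  Z : Point n → Bool
  Z = commonZero 𝔽 fs

  inM : Point n → Point n → Bool
  inM x = inSpanᵇ p ((x -v p) ∷ V)

  ∉L : ∀ x → inL x ≡ false → ¬ InSpan p V x
  ∉L x x∉L x∈L with trans (sym (inSpanᵇ-complete p V x x∈L)) x∉L
  ... | ()

  M : ∀ x → inL x ≡ false → AffSub 𝔽 n (suc k)
  M x x∉L = record { base = p ; dirs = (x -v p) ∷ V ; indep = extend-independent p x V (indep L) (∉L x x∉L) }

  L⊆M : ∀ x x∉L → _⊆A_ 𝔽 L (M x x∉L)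
  L⊆M x _ = InSpan-extend p (x -v p) V

  inL⇒inM : ∀ x y → inL y ≡ true → inM x y ≡ true
  inL⇒inM x y y∈L = inSpanᵇ-complete p _ y (InSpan-extend p (x -v p) V y (inSpanᵇ-sound p V y y∈L))

  -- For x, y ∉ L: y ∈ M x iff x ∈ M y (both say that L, x, y span the same M).
  inM-symmetric : ∀ x y → inL x ≡ false → inL y ≡ false → inM x y ≡ inM y x
  inM-symmetric x y x∉L y∉L = ⇔→≡ (mk⇔ (swap x y y∉L) (swap y x x∉L))
    where
    swap : ∀ x y → inL y ≡ false → inM x y ≡ true → inM y x ≡ true
    swap x y y∉L y∈Mx = inSpanᵇ-complete p _ x (extend-swap p x y V (∉L y y∉L) (inSpanᵇ-sound p _ y y∈Mx))

  N_L R J K : ℕ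
  N_L = 𝒩A 𝔽 fs L
  R   = Σ 𝔸 (λ y → [ not (inL y) ∧ Z y ])
  J   = Σ 𝔸 (λ x → [ not (inL x) ])
  K   = q ^ suc k ∸ q ^ k                      -- points of each M y outside L

  S : Point n → ℕ
  S x = Σ 𝔸 (λ y → [ inM x y ∧ (not (inL y) ∧ Z y) ])

  𝒩M : ∀ x x∉L → 𝒩A 𝔽 fs (M x x∉L) ≡ N_L + S x
  𝒩M x x∉L = trans (count-Σ (λ y → inM x y ∧ Z y) 𝔸)
    (trans (Σ-split 𝔸 inL (inM x) Z (inL⇒inM x)) (cong (_+ S x) (sym (count-Σ (λ y → inL y ∧ Z y) 𝔸))))

  𝒩all-split : 𝒩all 𝔽 fs ≡ N_L + R
  𝒩all-split = trans (count-Σ (λ y → true ∧ Z y) 𝔸)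
    (trans (Σ-split 𝔸 inL (λ _ → true) Z (λ _ _ → refl)) (cong (_+ R) (sym (count-Σ (λ y → inL y ∧ Z y) 𝔸))))

  #outside-L : J + q ^ k ≡ q ^ n
  #outside-L = begin
    J + q ^ k                                               ≡⟨ cong (J +_) (#InSpan p V (indep L)) ⟨
    J + Σ 𝔸 (λ x → [ inL x ])                               ≡⟨ Σ-+ 𝔸 _ _ ⟨
    Σ 𝔸 (λ x → [ not (inL x) ] + [ inL x ])                 ≡⟨ Σ-cong 𝔸 (λ x → one (inL x)) ⟩
    Σ 𝔸 (λ _ → 1)                                           ≡⟨ #allPoints n ⟩
    q ^ n                                                   ∎
    where
    open ≡-Reasoning
    one : ∀ b → [ not b ] + [ b ] ≡ 1
    one true  = refl
    one false = refl

  #K : K + q ^ k ≡ q ^ suc k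
  #K = m∸n+n≡m (^-monoʳ-≤ q {{q≢0}} (n≤1+n k))

  #M-outside-L : ∀ y → inL y ≡ false → Σ 𝔸 (λ x → [ inM y x ∧ (not (inL x) ∧ true) ]) ≡ K
  #M-outside-L y y∉L = begin
    outside                   ≡⟨ m+n∸n≡m outside (q ^ k) ⟨
    outside + q ^ k ∸ q ^ k   ≡⟨ cong (_∸ q ^ k) (trans (+-comm outside (q ^ k)) split) ⟩
    q ^ suc k ∸ q ^ k         ∎
    where
    open ≡-Reasoning
    outside : ℕ
    outside = Σ 𝔸 (λ x → [ inM y x ∧ (not (inL x) ∧ true) ])
    split : q ^ k + outside ≡ q ^ suc k
    split = begin
      q ^ k + outside                          ≡⟨ cong (_+ outside) (trans (Σ-cong 𝔸 (λ x → cong [_] (∧-identityʳ (inL x)))) (#InSpan p V (indep L))) ⟨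
      Σ 𝔸 (λ x → [ inL x ∧ true ]) + outside   ≡⟨ Σ-split 𝔸 inL (inM y) (λ _ → true) (inL⇒inM y) ⟨
      Σ 𝔸 (λ x → [ inM y x ∧ true ])           ≡⟨ Σ-cong 𝔸 (λ x → cong [_] (∧-identityʳ (inM y x))) ⟩
      Σ 𝔸 (λ x → [ inM y x ])                  ≡⟨ #InSpan p ((y -v p) ∷ V) (indep (M y y∉L)) ⟩
      q ^ suc k                                ∎

  incidence-swap : ∀ x y → not (inL x) ∧ (inM x y ∧ (not (inL y) ∧ Z y))
                           ≡ (not (inL y) ∧ Z y) ∧ (inM y x ∧ (not (inL x) ∧ true))
  incidence-swap x y with inL x in x∉L | inL y in y∉L
  ... | true  | b     = sym (trans (cong ((not b ∧ Z y) ∧_) (∧-zeroʳ (inM y x))) (∧-zeroʳ (not b ∧ Z y)))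
  ... | false | true  = ∧-zeroʳ (inM x y)
  ... | false | false = begin
    inM x y ∧ Z y            ≡⟨ ∧-comm (inM x y) (Z y) ⟩
    Z y ∧ inM x y            ≡⟨ cong (Z y ∧_) (inM-symmetric x y x∉L y∉L) ⟩
    Z y ∧ inM y x            ≡⟨ cong (Z y ∧_) (∧-identityʳ (inM y x)) ⟨
    Z y ∧ (inM y x ∧ true)   ∎
    where open ≡-Reasoning

  -- Σ_{x ∉ L} S x = K·R: each zero y ∉ L lies in M x for exactly K points x ∉ L.
  Σ-outside-S : Σ 𝔸 (λ x → [ not (inL x) ] * S x) ≡ K * R
  Σ-outside-S = begin
    Σ 𝔸 (λ x → [ not (inL x) ] * S x)
      ≡⟨ Σ-cong 𝔸 (λ x → Σ-*ˡ 𝔸 [ not (inL x) ] (λ y → [ inM x y ∧ (not (inL y) ∧ Z y) ])) ⟨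
    Σ 𝔸 (λ x → Σ 𝔸 (λ y → [ not (inL x) ] * [ inM x y ∧ (not (inL y) ∧ Z y) ]))
      ≡⟨ Σ-swap 𝔸 𝔸 _ ⟩
    Σ 𝔸 (λ y → Σ 𝔸 (λ x → [ not (inL x) ] * [ inM x y ∧ (not (inL y) ∧ Z y) ]))
      ≡⟨ Σ-cong 𝔸 (λ y → Σ-cong 𝔸 (λ x → swapped x y)) ⟩
    Σ 𝔸 (λ y → Σ 𝔸 (λ x → [ not (inL y) ∧ Z y ] * [ inM y x ∧ (not (inL x) ∧ true) ]))
      ≡⟨ Σ-cong 𝔸 (λ y → Σ-*ˡ 𝔸 [ not (inL y) ∧ Z y ] (λ x → [ inM y x ∧ (not (inL x) ∧ true) ])) ⟩
    Σ 𝔸 (λ y → [ not (inL y) ∧ Z y ] * Σ 𝔸 (λ x → [ inM y x ∧ (not (inL x) ∧ true) ]))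
      ≡⟨ Σ-cong 𝔸 count-M-outside-L ⟩
    Σ 𝔸 (λ y → [ not (inL y) ∧ Z y ] * K)
      ≡⟨ Σ-*ʳ 𝔸 (λ y → [ not (inL y) ∧ Z y ]) K ⟩
    R * K
      ≡⟨ *-comm R K ⟩
    K * R ∎
    where
    open ≡-Reasoning
    swapped : ∀ x y → [ not (inL x) ] * [ inM x y ∧ (not (inL y) ∧ Z y) ]
                      ≡ [ not (inL y) ∧ Z y ] * [ inM y x ∧ (not (inL x) ∧ true) ]
    swapped x y = begin
      [ not (inL x) ] * [ inM x y ∧ (not (inL y) ∧ Z y) ]          ≡⟨ [∧]≡[]*[] (not (inL x)) _ ⟨
      [ not (inL x) ∧ (inM x y ∧ (not (inL y) ∧ Z y)) ]           ≡⟨ cong [_] (incidence-swap x y) ⟩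
      [ (not (inL y) ∧ Z y) ∧ (inM y x ∧ (not (inL x) ∧ true)) ]  ≡⟨ [∧]≡[]*[] (not (inL y) ∧ Z y) _ ⟩
      [ not (inL y) ∧ Z y ] * [ inM y x ∧ (not (inL x) ∧ true) ]  ∎
    count-M-outside-L : ∀ y → [ not (inL y) ∧ Z y ] * Σ 𝔸 (λ x → [ inM y x ∧ (not (inL x) ∧ true) ])
                              ≡ [ not (inL y) ∧ Z y ] * K
    count-M-outside-L y with inL y in y∉L
    ... | true  = refl
    ... | false = cong ([ Z y ] *_) (#M-outside-L y y∉L)

  double-count : ∀ N' → (∀ x x∉L → N' ≤ 𝒩A 𝔽 fs (M x x∉L)) → J * N' ≤ J * N_L + K * R
  double-count N' N'≤𝒩M = begin
    J * N'                                                                    ≡⟨ Σ-*ʳ 𝔸 (λ x → [ not (inL x) ]) N' ⟨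
    Σ 𝔸 (λ x → [ not (inL x) ] * N')                                          ≤⟨ Σ-mono 𝔸 bound ⟩
    Σ 𝔸 (λ x → [ not (inL x) ] * (N_L + S x))                                 ≡⟨ Σ-cong 𝔸 (λ x → *-distribˡ-+ [ not (inL x) ] N_L (S x)) ⟩
    Σ 𝔸 (λ x → [ not (inL x) ] * N_L + [ not (inL x) ] * S x)                 ≡⟨ Σ-+ 𝔸 _ _ ⟩
    Σ 𝔸 (λ x → [ not (inL x) ] * N_L) + Σ 𝔸 (λ x → [ not (inL x) ] * S x)    ≡⟨ cong₂ _+_ (Σ-*ʳ 𝔸 (λ x → [ not (inL x) ]) N_L) Σ-outside-S ⟩
    J * N_L + K * R                                                           ∎
    where
    open ≤-Reasoning
    bound : ∀ x → [ not (inL x) ] * N' ≤ [ not (inL x) ] * (N_L + S x)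
    bound x with inL x in x∉L
    ... | true  = z≤n
    ... | false = *-monoʳ-≤ 1 (≤-trans (N'≤𝒩M x x∉L) (≤-reflexive (𝒩M x x∉L)))

open import Data.Nat using (ℕ; suc; _≤_; _∸_; _^_)
open import Data.Nat.Base using (>-nonZero⁻¹)
open import Data.Integer using (+_; _*_; _-_; _≥_) renaming (_+_ to _+ℤ_)
open import Relation.Binary.PropositionalEquality using (_≡_)

lemma1 : ∀ {c ℓ} (𝔽 : FiniteField c ℓ) (n r : ℕ) (fs : Vec (Poly 𝔽 n) r)
    (k₀ : ℕ) (L₀ : AffSub 𝔽 n k₀) (k : ℕ) (L : AffSub 𝔽 n k) →
    _⊆A_ 𝔽 L₀ L → 𝒩A 𝔽 fs L ≡ 𝒩A 𝔽 fs L₀ →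
    (∀ (m : ℕ) (M : AffSub 𝔽 n m) → _⊆A_ 𝔽 L₀ M → 𝒩A 𝔽 fs M ≡ 𝒩A 𝔽 fs L₀ → m ≤ k) →
    (L′ : AffSub 𝔽 n (suc k)) → _⊆A_ 𝔽 L L′ →
    (∀ (M : AffSub 𝔽 n (suc k)) → _⊆A_ 𝔽 L M → 𝒩A 𝔽 fs L′ ≤ 𝒩A 𝔽 fs M) →
    (+ (FiniteField.q 𝔽 ∸ 1)) * (+ 𝒩all 𝔽 fs)
      ≥ ((+ (FiniteField.q 𝔽 ∸ 1)) * (+ 𝒩A 𝔽 fs L)
         +ℤ ((+ (FiniteField.q 𝔽 ^ (n ∸ k))) - (+ 1)) * ((+ 𝒩A 𝔽 fs L′) - (+ 𝒩A 𝔽 fs L)))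
lemma1 𝔽 n r fs k₀ L₀ k L _ _ _ L′ _ L′-minimal =
  final-inequality q k n (𝒩all 𝔽 fs) (𝒩A 𝔽 fs L) R (𝒩A 𝔽 fs L′) J K
    𝒩all-split (>-nonZero⁻¹ q {{q≢0}}) #outside-L #K
    (double-count (𝒩A 𝔽 fs L′) (λ x x∉L → L′-minimal (M x x∉L) (L⊆M x x∉L)))
  where
  open FiniteField 𝔽 using (q)
  open Enumeration 𝔽 using (q≢0)
  open DoubleCounting 𝔽 fs L
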